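{- Let $\mathcal{F}\subseteq 2^{[n]}$ be such that $G_\mathcal{F}$ is disconnected and, for every $X\in 2^{[n]}\setminus\mathcal{F}$, the graph $G_{\mathcal{F}\cup\{X\}}$ is connected. Suppose $G_\mathcal{F}$ consists of two components with vertex sets $\mathcal{A}$ and $\mathcal{B}$. Then \[ |\mathcal{F}|\le 2^n-|\partial^+(\mathcal{F}^+)|-|\partial^-(\mathcal{F}^-)|. \]
   Context: For $\mathcal{F}\subseteq 2^{[n]}$, $G_\mathcal{F}$ is the graph on $\mathcal{F}$ with distinct $A,B$ adjacent iff $A\subseteq B$ or $B\subseteq A$. For a family $\mathcal{G}$, $\partial^+(\mathcal{G})=\{X\subseteq[n]: G\subseteq X\text{ for some }G\in\mathcal{G}\}$ and $\partial^-(\mathcal{G})=\{X\subseteq[n]: X\subseteq G\text{ for some }G\in\mathcal{G}\}$. Define $\mathcal{F}^+$ as the set of $F\subseteq[n]$ with $F\notin\partial^-(\mathcal{A})\cup\partial^-(\mathcal{B})$ such that every proper subset $F'\subsetneq F$ lies in $\partial^-(\mathcal{A})\cup\partial^-(\mathcal{B})$; and $\mathcal{F}^-$ as the set of $F\subseteq[n]$ with $F\notin\partial^+(\mathcal{A})\cup\partial^+(\mathcal{B})$ such that every proper superset $F'\supsetneq F$ lies in $\partial^+(\mathcal{A})\cup\partial^+(\mathcal{B})$. -}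

module Defs where

open import Data.Nat using (ℕ; zero; suc; _+_)
open import Data.Bool using (Bool; true; false; _∧_; _∨_; not; if_then_else_)
open import Data.List using (List; []; _∷_; [_]; map; _++_)
open import Data.Bool.ListAction using (any; all)
open import Data.Vec using ([]; _∷_)
open import Data.Vec.Properties using (≡-dec)
open import Data.Bool.Properties using () renaming (_≟_ to _≟ᴮ_)
open import Data.Fin.Subset using (Subset; inside; outside; _⊆_)
open import Data.Fin.Subset.Properties using (_⊆?_; _⊂?_)
open import Data.Product using (_×_; ∃)
open import Data.Sum using (_⊎_)
open import Relation.Nullary using (¬_; does)
open import Relation.Binary.PropositionalEquality using (_≡_)

Family : ℕ → Set
Family n = Subset n → Bool

allSubsets : (n : ℕ) → List (Subset n)
allSubsets zero = [ [] ]
allSubsets (suc n) = map (outside ∷_) (allSubsets n) ++ map (inside ∷_) (allSubsets n)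

count : {A : Set} → List A → (A → Bool) → ℕ
count [] P = 0
count (x ∷ xs) P = (if P x then 1 else 0) + count xs P

card : {n : ℕ} → Family n → ℕ
card {n} F = count (allSubsets n) F

insert : {n : ℕ} → Family n → Subset n → Family n
insert F X Y = F Y ∨ does (≡-dec _≟ᴮ_ Y X)

up : {n : ℕ} → Family n → Family n
up {n} G X = any (λ Y → G Y ∧ does (Y ⊆? X)) (allSubsets n)

down : {n : ℕ} → Family n → Family n
down {n} G X = any (λ Y → G Y ∧ does (X ⊆? Y)) (allSubsets n)

Fplus : {n : ℕ} → Family n → Family n → Family n
Fplus {n} A B X =
  not (down A X ∨ down B X) ∧
  all (λ Y → not (does (Y ⊂? X)) ∨ (down A Y ∨ down B Y)) (allSubsets n)

Fminus : {n : ℕ} → Family n → Family n → Family n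
Fminus {n} A B X =
  not (up A X ∨ up B X) ∧
  all (λ Y → not (does (X ⊂? Y)) ∨ (up A Y ∨ up B Y)) (allSubsets n)

-- Comparability graph G_𝓕
Comparable : {n : ℕ} → Subset n → Subset n → Set
Comparable X Y = X ⊆ Y ⊎ Y ⊆ X

Adjacent : {n : ℕ} → Family n → Subset n → Subset n → Set
Adjacent F X Y = F X ≡ true × F Y ≡ true × ¬ (X ≡ Y) × Comparable X Y

data Reach {n : ℕ} (F : Family n) (X : Subset n) : Subset n → Set where
  here : F X ≡ true → Reach F X X
  step : ∀ {Y Z} → Reach F X Y → Adjacent F Y Z → Reach F X Z

Connected : {n : ℕ} → Family n → Set
Connected F = ∀ X Y → F X ≡ true → F Y ≡ true → Reach F X Y

TwoComponents : {n : ℕ} → Family n → Family n → Family n → Set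
TwoComponents F A B =
  (∀ X → F X ≡ (A X ∨ B X)) ×
  (∀ X → A X ≡ true → B X ≡ false) ×
  ∃ (λ X → A X ≡ true) ×
  ∃ (λ X → B X ≡ true) ×
  Connected A ×
  Connected B ×
  (∀ X Y → A X ≡ true → B Y ≡ true → ¬ Comparable X Y)

{-# OPTIONS --safe #-}
-- F, ∂⁺(F⁺) and ∂⁻(F⁻) are pairwise disjoint subfamilies of 2^[n]. A set above a member
-- Y of F⁺ lies below no member G of F = 𝓐 ∪ 𝓑, since otherwise Y ∈ ∂⁻𝓐 ∪ ∂⁻𝓑; in
-- particular it is not in F. Dually for sets below a member of F⁻. A set X of both
-- kinds is therefore incomparable with every member of F, so it is an isolated vertex of
-- G_{F ∪ {X}}, contradicting the maximality of F.
module Submission where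

open import Defs
open import Data.Nat using (ℕ; zero; suc; _+_; _≤_; _^_; z≤n; s≤s)
open import Data.Nat.Properties using (+-suc; +-identityʳ; ≤-reflexive; m≤n⇒m≤1+n; ≤-trans; module ≤-Reasoning)
open import Data.Bool using (Bool; true; false; _∧_; _∨_)
open import Data.Bool.Properties using (T-≡; ∨-zeroʳ; ∧-conicalˡ; ∧-conicalʳ; not-injective)
  renaming (_≟_ to _≟ᴮ_)
open import Data.Bool.ListAction using (any)
open import Data.List using (List; []; _∷_; map; _++_; length)
open import Data.List.Properties using (length-++; length-map)
open import Data.List.Membership.Propositional using (_∈_; lose)
open import Data.List.Membership.Propositional.Properties using (∈-map⁺; ∈-++⁺ˡ; ∈-++⁺ʳ)
open import Data.List.Relation.Unary.Any using (here; satisfied)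
open import Data.List.Relation.Unary.Any.Properties using (any⁺; any⁻)
open import Data.Vec using ([]; _∷_)
open import Data.Vec.Properties using (≡-dec)
open import Data.Fin.Subset using (Subset; inside; outside; _⊆_)
open import Data.Fin.Subset.Properties using (_⊆?_; ⊆-refl; ⊆-trans)
open import Data.Product using (_×_; ∃; _,_; map₂)
open import Data.Sum using (_⊎_; inj₁; inj₂)
open import Data.Empty using (⊥; ⊥-elim)
open import Function.Bundles using (Equivalence)
open import Relation.Nullary using (¬_; Dec; yes; does)
open import Relation.Nullary.Decidable using (dec-true; dec-false)
open import Relation.Binary.PropositionalEquality using (_≡_; _≢_; refl; sym; trans; cong; cong₂; subst; module ≡-Reasoning)

open Equivalence using (to; from)

∨-true : ∀ {a b} → a ∨ b ≡ true → a ≡ true ⊎ b ≡ true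
∨-true {true}  _ = inj₁ refl
∨-true {false} e = inj₂ e

does-true⇒ : ∀ {P : Set} (p? : Dec P) → does p? ≡ true → P
does-true⇒ (yes p) _ = p

Disjoint : {S : Set} → (S → Bool) → (S → Bool) → Set
Disjoint P Q = ∀ x → P x ≡ true → Q x ≡ true → ⊥

count-∨ : {S : Set} (xs : List S) {P Q : S → Bool} → Disjoint P Q →
          count xs (λ x → P x ∨ Q x) ≡ count xs P + count xs Q
count-∨ [] _ = refl
count-∨ (x ∷ xs) {P} {Q} disj with P x in p | Q x in q
... | true  | true  = ⊥-elim (disj x p q)
... | true  | false = cong suc (count-∨ xs disj)
... | false | true  = trans (cong suc (count-∨ xs disj)) (sym (+-suc (count xs P) (count xs Q)))
... | false | false = count-∨ xs disj

count≤length : {S : Set} (xs : List S) (P : S → Bool) → count xs P ≤ length xs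
count≤length []       P = z≤n
count≤length (x ∷ xs) P with P x
... | true  = s≤s (count≤length xs P)
... | false = m≤n⇒m≤1+n (count≤length xs P)

length-allSubsets : ∀ n → length (allSubsets n) ≡ 2 ^ n
length-allSubsets zero    = refl
length-allSubsets (suc n) = begin
  length (map (outside ∷_) (allSubsets n) ++ map (inside ∷_) (allSubsets n))
    ≡⟨ length-++ (map (outside ∷_) (allSubsets n)) ⟩
  length (map (outside ∷_) (allSubsets n)) + length (map (inside ∷_) (allSubsets n))
    ≡⟨ cong₂ _+_ (length-map (outside ∷_) (allSubsets n)) (length-map (inside ∷_) (allSubsets n)) ⟩
  length (allSubsets n) + length (allSubsets n)
    ≡⟨ cong₂ _+_ (length-allSubsets n) (trans (length-allSubsets n) (sym (+-identityʳ (2 ^ n)))) ⟩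
  2 ^ suc n ∎
  where open ≡-Reasoning

card≤2^n : ∀ {n} (F : Family n) → card F ≤ 2 ^ n
card≤2^n {n} F = ≤-trans (count≤length (allSubsets n) F) (≤-reflexive (length-allSubsets n))

∈-allSubsets : ∀ {n} (X : Subset n) → X ∈ allSubsets n
∈-allSubsets []            = here refl
∈-allSubsets (outside ∷ X) = ∈-++⁺ˡ (∈-map⁺ (outside ∷_) (∈-allSubsets X))
∈-allSubsets (inside ∷ X)  = ∈-++⁺ʳ (map (outside ∷_) _) (∈-map⁺ (inside ∷_) (∈-allSubsets X))

any-allSubsets⁺ : ∀ {n} (P : Subset n → Bool) {X} → P X ≡ true → any P (allSubsets n) ≡ true
any-allSubsets⁺ P {X} e = to T-≡ (any⁺ P (lose (∈-allSubsets X) (from T-≡ e)))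

any-witness : {S : Set} (P : S → Bool) (xs : List S) → any P xs ≡ true → ∃ λ x → P x ≡ true
any-witness P xs e = map₂ (to T-≡) (satisfied (any⁻ P xs (from T-≡ e)))

down⁺ : ∀ {n} (G : Family n) {X Y} → G Y ≡ true → X ⊆ Y → down G X ≡ true
down⁺ G {X} {Y} gY X⊆Y = any-allSubsets⁺ (λ Z → G Z ∧ does (X ⊆? Z)) (cong₂ _∧_ gY (dec-true (X ⊆? Y) X⊆Y))

up⁺ : ∀ {n} (G : Family n) {X Y} → G Y ≡ true → Y ⊆ X → up G X ≡ true
up⁺ G {X} {Y} gY Y⊆X = any-allSubsets⁺ (λ Z → G Z ∧ does (Z ⊆? X)) (cong₂ _∧_ gY (dec-true (Y ⊆? X) Y⊆X))

down⁻ : ∀ {n} (G : Family n) {X} → down G X ≡ true → ∃ λ Y → G Y ≡ true × X ⊆ Y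
down⁻ {n} G {X} e with any-witness _ (allSubsets n) e
... | Y , e′ = Y , ∧-conicalˡ _ _ e′ , does-true⇒ (X ⊆? Y) (∧-conicalʳ _ _ e′)

up⁻ : ∀ {n} (G : Family n) {X} → up G X ≡ true → ∃ λ Y → G Y ≡ true × Y ⊆ X
up⁻ {n} G {X} e with any-witness _ (allSubsets n) e
... | Y , e′ = Y , ∧-conicalˡ _ _ e′ , does-true⇒ (Y ⊆? X) (∧-conicalʳ _ _ e′)

module _ {n : ℕ} (A B : Family n) where

  down-∨⁺ : ∀ {X G} → A G ∨ B G ≡ true → X ⊆ G → down A X ∨ down B X ≡ true
  down-∨⁺ {X} {G} e X⊆G with ∨-true e
  ... | inj₁ aG = cong (_∨ down B X) (down⁺ A aG X⊆G)
  ... | inj₂ bG = trans (cong (down A X ∨_) (down⁺ B bG X⊆G)) (∨-zeroʳ (down A X))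

  up-∨⁺ : ∀ {X G} → A G ∨ B G ≡ true → G ⊆ X → up A X ∨ up B X ≡ true
  up-∨⁺ {X} {G} e G⊆X with ∨-true e
  ... | inj₁ aG = cong (_∨ up B X) (up⁺ A aG G⊆X)
  ... | inj₂ bG = trans (cong (up A X ∨_) (up⁺ B bG G⊆X)) (∨-zeroʳ (up A X))

  Fplus⇒∉down : ∀ {X} → Fplus A B X ≡ true → down A X ∨ down B X ≡ false
  Fplus⇒∉down e = not-injective (∧-conicalˡ _ _ e)

  Fminus⇒∉up : ∀ {X} → Fminus A B X ≡ true → up A X ∨ up B X ≡ false
  Fminus⇒∉up e = not-injective (∧-conicalˡ _ _ e)

  up-Fplus-⊈ : ∀ {X G} → up (Fplus A B) X ≡ true → A G ∨ B G ≡ true → ¬ X ⊆ G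
  up-Fplus-⊈ u e X⊆G with up⁻ (Fplus A B) u
  ... | Y , fY , Y⊆X with () ← trans (sym (down-∨⁺ e (⊆-trans Y⊆X X⊆G))) (Fplus⇒∉down fY)

  down-Fminus-⊉ : ∀ {X G} → down (Fminus A B) X ≡ true → A G ∨ B G ≡ true → ¬ G ⊆ X
  down-Fminus-⊉ d e G⊆X with down⁻ (Fminus A B) d
  ... | Y , fY , X⊆Y with () ← trans (sym (up-∨⁺ e (⊆-trans G⊆X X⊆Y))) (Fminus⇒∉up fY)

  up-Fplus∩down-Fminus-incomparable : ∀ {X G} → up (Fplus A B) X ≡ true → down (Fminus A B) X ≡ true →
                                     A G ∨ B G ≡ true → ¬ Comparable G X
  up-Fplus∩down-Fminus-incomparable u d e (inj₁ G⊆X) = down-Fminus-⊉ d e G⊆X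
  up-Fplus∩down-Fminus-incomparable u d e (inj₂ X⊆G) = up-Fplus-⊈ u e X⊆G

Isolated : ∀ {n} → Family n → Subset n → Set
Isolated F X = ∀ Y → ¬ Adjacent F Y X

Reach-isolated : ∀ {n} {F : Family n} {a X} → Isolated F X → Reach F a X → a ≡ X
Reach-isolated iso (here _)            = refl
Reach-isolated iso (step {Y = Y} _ adj) = ⊥-elim (iso Y adj)

Incomparable : ∀ {n} → Family n → Subset n → Set
Incomparable F X = ∀ G → F G ≡ true → ¬ Comparable G X

module _ {n : ℕ} (F : Family n) (X : Subset n) where

  insert-⊇ : ∀ {Y} → F Y ≡ true → insert F X Y ≡ true
  insert-⊇ e = cong (_∨ _) e

  insert-self : insert F X X ≡ true
  insert-self = trans (cong (F X ∨_) (dec-true (≡-dec _≟ᴮ_ X X) refl)) (∨-zeroʳ (F X))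

  insert-≢ : ∀ {Y} → insert F X Y ≡ true → Y ≢ X → F Y ≡ true
  insert-≢ {Y} e Y≢X with F Y
  ... | true  = refl
  ... | false with () ← trans (sym e) (dec-false (≡-dec _≟ᴮ_ Y X) Y≢X)

  incomparable⇒∉ : Incomparable F X → F X ≡ false
  incomparable⇒∉ inc with F X in e
  ... | true  = ⊥-elim (inc X e (inj₁ ⊆-refl))
  ... | false = refl

  incomparable⇒isolated : Incomparable F X → Isolated (insert F X) X
  incomparable⇒isolated inc Y (iY , _ , Y≢X , Y~X) = inc Y (insert-≢ iY Y≢X) Y~X

saturated⇒comparable : ∀ {n} {F : Family n} {a X} → (∀ Y → F Y ≡ false → Connected (insert F Y)) →
                       F a ≡ true → ¬ Incomparable F X
saturated⇒comparable {F = F} {a} {X} saturated fa inc = inc a fa (inj₁ (subst (a ⊆_) a≡X ⊆-refl))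
  where
  a≡X : a ≡ X
  a≡X = Reach-isolated (incomparable⇒isolated F X inc)
          (saturated X (incomparable⇒∉ F X inc) a X (insert-⊇ F X fa) (insert-self F X))

lemma4p3 : (n : ℕ) (F A B : Family n) →
           ¬ Connected F →
           (∀ X → F X ≡ false → Connected (insert F X)) →
           TwoComponents F A B →
           card F + card (up (Fplus A B)) + card (down (Fminus A B)) ≤ 2 ^ n
lemma4p3 n F A B _ saturated (F≡A∪B , _ , (a , aA) , _) = begin
  card F + card U + card D              ≡⟨ cong (_+ card D) (count-∨ (allSubsets n) F∩U=∅) ⟨
  card (λ X → F X ∨ U X) + card D       ≡⟨ count-∨ (allSubsets n) F∪U∩D=∅ ⟨
  card (λ X → (F X ∨ U X) ∨ D X)        ≤⟨ card≤2^n (λ X → (F X ∨ U X) ∨ D X) ⟩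
  2 ^ n                                 ∎
  where
  open ≤-Reasoning
  U D : Family n
  U = up (Fplus A B)
  D = down (Fminus A B)

  A∪B : ∀ {X} → F X ≡ true → A X ∨ B X ≡ true
  A∪B {X} e = trans (sym (F≡A∪B X)) e

  F∩U=∅ : Disjoint F U
  F∩U=∅ X fX uX = up-Fplus-⊈ A B uX (A∪B fX) ⊆-refl

  F∪U∩D=∅ : Disjoint (λ X → F X ∨ U X) D
  F∪U∩D=∅ X e dX with ∨-true e
  ... | inj₁ fX = down-Fminus-⊉ A B dX (A∪B fX) ⊆-refl
  ... | inj₂ uX = saturated⇒comparable saturated (trans (F≡A∪B a) (cong (_∨ B a) aA))
                    (λ G fG → up-Fplus∩down-Fminus-incomparable A B uX dX (A∪B fG))
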